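{- Every $\lambda_{\circledR}$-normal form is typeable in $\lambda_{\circledR}\cap$: if $M\in\Lambda_{\circledR}$ contains no redex (no subterm, modulo structural equivalence, to which a reduction rule applies), then there exist a basis $\Gamma$ and a strict type $\sigma$ with $\Gamma\vdash M:\sigma$.
   Context: Terms. Fix a countably infinite set of variables. The set $\Lambda_{\circledR}$ of terms and $Fv(M)$ are defined simultaneously: every variable $x$ is a term with $Fv(x)=\{x\}$; $\lambda x.M$ is a term if $M$ is a term and $x\in Fv(M)$ ($Fv=Fv(M)\setminus\{x\}$); $MN$ is a term if $M,N$ are terms with $Fv(M)\cap Fv(N)=\emptyset$ ($Fv=Fv(M)\cup Fv(N)$); $x\odot M$ (erasure) is a term if $M$ is a term and $x\notin Fv(M)$ ($Fv=\{x\}\cup Fv(M)$); $x<^{x_1}_{x_2}M$ (duplication) is a term if $M$ is a term, $x_1,x_2\in Fv(M)$, $x_1\neq x_2$, $x\notin Fv(M)\setminus\{x_1,x_2\}$ ($Fv=\{x\}\cup(Fv(M)\setminus\{x_1,x_2\})$). $\alpha$-conversion and Barendregt's convention assumed. Reduction rules (redex $\to$ contractum; $M\langle N/x\rangle$ denotes substitution of $N$ for $x$ in $M$ in the resource-aware sense): $(\lambda x.M)N\to M\langle N/x\rangle$; $x<^{x_1}_{x_2}(\lambda y.M)\to\lambda y.x<^{x_1}_{x_2}M$; $x<^{x_1}_{x_2}(MN)\to(x<^{x_1}_{x_2}M)N$ if $x_1,x_2\notin Fv(N)$; $x<^{x_1}_{x_2}(MN)\to M(x<^{x_1}_{x_2}N)$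 if $x_1,x_2\notin Fv(M)$; $\lambda x.(y\odot M)\to y\odot(\lambda x.M)$ ($x\neq y$); $(x\odot M)N\to x\odot(MN)$; $M(x\odot N)\to x\odot(MN)$; $x<^{x_1}_{x_2}(y\odot M)\to y\odot(x<^{x_1}_{x_2}M)$ ($y\ne x_1,x_2$); $x<^{x_1}_{x_2}(x_1\odot M)\to M\langle x/x_2\rangle$. Structural equivalence: least equivalence closed under $\alpha$-conversion containing $x\odot(y\odot M)\equiv y\odot(x\odot M)$; $x<^{x_1}_{x_2}M\equiv x<^{x_2}_{x_1}M$; $x<^{y}_{z}(y<^{u}_{v}M)\equiv x<^{y}_{u}(y<^{z}_{v}M)$; $x<^{x_1}_{x_2}(y<^{y_1}_{y_2}M)\equiv y<^{y_1}_{y_2}(x<^{x_1}_{x_2}M)$ if $x\ne y_1,y_2$, $y\ne x_1,x_2$. Types. Strict types $\sigma::=p\mid\alpha\to\sigma$; types $\alpha::=\cap_{i=1}^n\sigma_i$ ($=\top$ if $n=0$), with $\cap$ commutative, associative, $\top$ neutral. A basis $\Gamma$ maps a finite set $Dom(\Gamma)$ of variables to types; $\Gamma,x:\alpha$ extends by $x\notin Dom(\Gamma)$; for $Dom(\Gamma)=Dom(\Delta)$, $(\Gamma\sqcap\Delta)(x)=\Gamma(x)\cap\Delta(x)$; $\Gamma^{\top}$ maps $Dom(\Gamma)$ to $\top$. Rules of $\lambda_{\circledR}\cap$: (Ax) $x:\sigma\vdash x:\sigma$; ($\to_I$) from $\Gamma,x:\alpha\vdash M:\sigma$ infer $\Gamma\vdash\lambda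 x.M:\alpha\to\sigma$; ($\to_E$) from $\Gamma\vdash M:\cap_{i=1}^n\tau_i\to\sigma$ and $\Delta_0\vdash N:\tau_0,\dots,\Delta_n\vdash N:\tau_n$ infer $\Gamma,\Delta_0^{\top}\sqcap\Delta_1\sqcap\dots\sqcap\Delta_n\vdash MN:\sigma$; (Cont) from $\Gamma,x:\alpha,y:\beta\vdash M:\sigma$ infer $\Gamma,z:\alpha\cap\beta\vdash z<^{x}_{y}M:\sigma$; (Thin) from $\Gamma\vdash M:\sigma$ infer $\Gamma,x:\top\vdash x\odot M:\sigma$. -}

module Defs where

open import Data.Nat using (ℕ; _≟_)
open import Data.List using (List; []; _∷_; _++_; map; filter; foldl)
open import Data.List.Membership.Propositional using (_∈_; _∉_)
open import Data.List.Relation.Binary.Permutation.Propositional using (_↭_)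
open import Data.List.Relation.Binary.Pointwise using (Pointwise)
open import Data.List.Relation.Unary.All using (All)
open import Data.Product using (_×_; _,_; Σ; proj₁; proj₂)
open import Data.Bool using (if_then_else_; _∨_)
open import Relation.Nullary using (¬_)
open import Relation.Nullary.Decidable using (¬?; ⌊_⌋)
open import Relation.Binary.PropositionalEquality using (_≡_; _≢_)

Var : Set
Var = ℕ

data Term : Set where
  var : Var → Term
  lam : Var → Term → Term
  app : Term → Term → Term
  ers : Var → Term → Term
  dup : Var → Var → Var → Term → Term     -- dup x x₁ x₂ M  =  x <^{x₁}_{x₂} M

_∖_ : List Var → Var → List Var
xs ∖ x = filter (λ y → ¬? (y ≟ x)) xs

fv : Term → List Var
fv (var x)         = x ∷ []
fv (lam x M)       = fv M ∖ x
fv (app M N)       = fv M ++ fv N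
fv (ers x M)       = x ∷ fv M
fv (dup x x₁ x₂ M) = x ∷ ((fv M ∖ x₁) ∖ x₂)

vars : Term → List Var
vars (var x)         = x ∷ []
vars (lam x M)       = x ∷ vars M
vars (app M N)       = vars M ++ vars N
vars (ers x M)       = x ∷ vars M
vars (dup x x₁ x₂ M) = x ∷ x₁ ∷ x₂ ∷ vars M

data WF : Term → Set where
  wf-var : ∀ {x} → WF (var x)
  wf-lam : ∀ {x M} → WF M → x ∈ fv M → WF (lam x M)
  wf-app : ∀ {M N} → WF M → WF N →
           (∀ {y} → y ∈ fv M → y ∉ fv N) → WF (app M N)
  wf-ers : ∀ {x M} → WF M → x ∉ fv M → WF (ers x M)
  wf-dup : ∀ {x x₁ x₂ M} → WF M → x₁ ∈ fv M → x₂ ∈ fv M → x₁ ≢ x₂ →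
           x ∉ ((fv M ∖ x₁) ∖ x₂) → WF (dup x x₁ x₂ M)

-- Renaming of free occurrences of x into y (capture-free when y does not
-- occur in the term at all); used for α-conversion.

rn : Var → Var → Term → Term
rn x y (var z)         = var (if ⌊ z ≟ x ⌋ then y else z)
rn x y (lam z M)       = if ⌊ z ≟ x ⌋ then lam z M else lam z (rn x y M)
rn x y (app M N)       = app (rn x y M) (rn x y N)
rn x y (ers z M)       = ers (if ⌊ z ≟ x ⌋ then y else z) (rn x y M)
rn x y (dup z z₁ z₂ M) =
  dup (if ⌊ z ≟ x ⌋ then y else z) z₁ z₂
      (if ⌊ z₁ ≟ x ⌋ ∨ ⌊ z₂ ≟ x ⌋ then M else rn x y M)

infix 4 _≡s_
data _≡s_ : Term → Term → Set where
  ≡-refl  : ∀ {M} → M ≡s M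
  ≡-sym   : ∀ {M N} → M ≡s N → N ≡s M
  ≡-trans : ∀ {M N P} → M ≡s N → N ≡s P → M ≡s P
  ≡-lam : ∀ {x M M'} → M ≡s M' → lam x M ≡s lam x M'
  ≡-app : ∀ {M M' N N'} → M ≡s M' → N ≡s N' → app M N ≡s app M' N'
  ≡-ers : ∀ {x M M'} → M ≡s M' → ers x M ≡s ers x M'
  ≡-dup : ∀ {x x₁ x₂ M M'} → M ≡s M' → dup x x₁ x₂ M ≡s dup x x₁ x₂ M'
  α-lam : ∀ {x y M} → y ∉ vars (lam x M) → lam x M ≡s lam y (rn x y M)
  α-dup : ∀ {x x₁ x₂ y M} → y ∉ vars (dup x x₁ x₂ M) →
          dup x x₁ x₂ M ≡s dup x y x₂ (rn x₁ y M)
  ax-ers-comm : ∀ {x y M} → ers x (ers y M) ≡s ers y (ers x M)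
  ax-dup-comm : ∀ {x x₁ x₂ M} → dup x x₁ x₂ M ≡s dup x x₂ x₁ M
  ax-dup-assoc : ∀ {x y z u v M} →
                 dup x y z (dup y u v M) ≡s dup x y u (dup y z v M)
  ax-dup-perm : ∀ {x x₁ x₂ y y₁ y₂ M} → x ≢ y₁ → x ≢ y₂ → y ≢ x₁ → y ≢ x₂ →
                dup x x₁ x₂ (dup y y₁ y₂ M) ≡s dup y y₁ y₂ (dup x x₁ x₂ M)

infix 4 _⊑_
data _⊑_ : Term → Term → Set where
  ⊑-refl : ∀ {M} → M ⊑ M
  ⊑-lam  : ∀ {N x M} → N ⊑ M → N ⊑ lam x M
  ⊑-appˡ : ∀ {N M P} → N ⊑ M → N ⊑ app M P
  ⊑-appʳ : ∀ {N M P} → N ⊑ P → N ⊑ app M P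
  ⊑-ers  : ∀ {N x M} → N ⊑ M → N ⊑ ers x M
  ⊑-dup  : ∀ {N x x₁ x₂ M} → N ⊑ M → N ⊑ dup x x₁ x₂ M

-- redexes: left-hand sides of the reduction rules (with side conditions)
data Redex : Term → Set where
  r-β       : ∀ {x M N} → Redex (app (lam x M) N)
  r-γ-lam   : ∀ {x x₁ x₂ y M} → Redex (dup x x₁ x₂ (lam y M))
  r-γ-appˡ  : ∀ {x x₁ x₂ M N} → x₁ ∉ fv N → x₂ ∉ fv N →
              Redex (dup x x₁ x₂ (app M N))
  r-γ-appʳ  : ∀ {x x₁ x₂ M N} → x₁ ∉ fv M → x₂ ∉ fv M →
              Redex (dup x x₁ x₂ (app M N))
  r-ω-lam   : ∀ {x y M} → x ≢ y → Redex (lam x (ers y M))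
  r-ω-appˡ  : ∀ {x M N} → Redex (app (ers x M) N)
  r-ω-appʳ  : ∀ {x M N} → Redex (app M (ers x N))
  r-γω      : ∀ {x x₁ x₂ y M} → y ≢ x₁ → y ≢ x₂ →
              Redex (dup x x₁ x₂ (ers y M))
  r-γω-same : ∀ {x x₁ x₂ M} → Redex (dup x x₁ x₂ (ers x₁ M))

NormalForm : Term → Set
NormalForm M = ∀ M' → M ≡s M' → ∀ N → N ⊑ M' → ¬ Redex N

-- Intersection types (intersections as lists, taken modulo ≈)

data Strict : Set where
  atom : ℕ → Strict
  _⇒_  : List Strict → Strict → Strict

Inter : Set
Inter = List Strict       -- [] is ⊤, _++_ is ∩

-- equivalence of types: ∩ commutative/associative, ⊤ neutral, congruence
mutual
  data _≈ₛ_ : Strict → Strict → Set where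
    ≈-atom : ∀ {p} → atom p ≈ₛ atom p
    ≈-⇒    : ∀ {α α' σ σ'} → α ≈ᵢ α' → σ ≈ₛ σ' → (α ⇒ σ) ≈ₛ (α' ⇒ σ')

  data _≈ᵢ_ : Inter → Inter → Set where
    ≈-perm : ∀ {α γ β} → α ↭ γ → Pointwise _≈ₛ_ γ β → α ≈ᵢ β

Basis : Set
Basis = List (Var × Inter)

dom : Basis → List Var
dom = map proj₁

look : Var → Basis → Inter
look x [] = []
look x ((y , α) ∷ Γ) = if ⌊ x ≟ y ⌋ then α else look x Γ

-- Γ ⊓ Δ  (used only when dom Γ and dom Δ coincide)
_⊓_ : Basis → Basis → Basis
Γ ⊓ Δ = map (λ p → (proj₁ p , proj₂ p ++ look (proj₁ p) Δ)) Γ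

top : Basis → Basis
top = map (λ p → (proj₁ p , []))

_≋_ : Basis → Basis → Set
Γ ≋ Γ' = Σ Basis λ Γ'' → (Γ ↭ Γ'') ×
         Pointwise (λ p q → (proj₁ p ≡ proj₁ q) × (proj₂ p ≈ᵢ proj₂ q)) Γ'' Γ'

Disjoint : List Var → List Var → Set
Disjoint xs ys = ∀ {z} → z ∈ xs → z ∉ ys

infix 3 _⊢_∶_
mutual
  data _⊢_∶_ : Basis → Term → Strict → Set where
    Ax   : ∀ {x σ} → ((x , σ ∷ []) ∷ []) ⊢ var x ∶ σ
    →I   : ∀ {Γ x α M σ} → x ∉ dom Γ →
           ((x , α) ∷ Γ) ⊢ M ∶ σ → Γ ⊢ lam x M ∶ (α ⇒ σ)
    →E   : ∀ {Γ M N α σ Δ₀ τ₀ Δs} →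
           Γ ⊢ M ∶ (α ⇒ σ) →
           Δ₀ ⊢ N ∶ τ₀ →
           Args N α Δs →
           All (λ Δ → dom Δ ↭ dom Δ₀) Δs →
           Disjoint (dom Γ) (dom Δ₀) →
           (Γ ++ foldl _⊓_ (top Δ₀) Δs) ⊢ app M N ∶ σ
    Cont : ∀ {Γ x y z α β M σ} →
           x ∉ dom Γ → y ∉ dom Γ → x ≢ y → z ∉ dom Γ →
           ((x , α) ∷ (y , β) ∷ Γ) ⊢ M ∶ σ →
           ((z , α ++ β) ∷ Γ) ⊢ dup z x y M ∶ σ
    Thin : ∀ {Γ x M σ} → x ∉ dom Γ →
           Γ ⊢ M ∶ σ → ((x , []) ∷ Γ) ⊢ ers x M ∶ σ
    conv : ∀ {Γ Γ' M σ σ'} → Γ ⊢ M ∶ σ → Γ ≋ Γ' → σ ≈ₛ σ' → Γ' ⊢ M ∶ σ'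

  data Args (N : Term) : Inter → List Basis → Set where
    []  : Args N [] []
    _∷_ : ∀ {Δ τ α Δs} → Δ ⊢ N ∶ τ → Args N α Δs → Args N (τ ∷ α) (Δ ∷ Δs)

-- The proof is by induction on the (well-formed, normal) term and proves
-- two statements simultaneously:
--   * a normal form that is neither an abstraction nor an erasure
--     ("neutral") can be given ANY strict type σ: its head is a variable,
--     which the axiom types with σ, applications are typed with the
--     argument at the neutral intersection ⊤, and duplications are typed
--     by contraction;
--   * every normal form has SOME strict type: abstractions and erasures
--     are typed from their bodies by (→I) and (Thin), everything else is
--     neutral.
-- Normality is used exactly where a neutral term is required: the head of
-- an application and the body of a duplication in a normal form are
-- neutral, since otherwise a β-, γ- or ω-redex would be visible.
-- To apply (→I) and (Cont) we keep track of the basis: it lists every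
-- free variable of the term exactly once (a "scope"), so the entries for
-- bound variables can be brought to the front by a permutation.

module Submission where

open import Defs
open import Data.Product using (Σ; _,_; _×_; proj₁; proj₂)
open import Data.Nat using (_≟_)
open import Data.List using (List; []; _∷_; _++_)
open import Data.List.Properties using (map-++; map-∘)
open import Data.List.Membership.Propositional using (_∈_; _∉_)
open import Data.List.Membership.Propositional.Properties
  using (∈-filter⁺; ∈-filter⁻)
open import Data.List.Relation.Unary.Any using (here; there)
open import Data.List.Relation.Unary.All as All using ([]; _∷_)
open import Data.List.Relation.Unary.AllPairs using ([]; _∷_)
open import Data.List.Relation.Unary.Unique.Propositional using (Unique)
open import Data.List.Relation.Unary.Unique.Propositional.Properties
  using (++⁺)
open import Data.List.Relation.Binary.Subset.Propositional using (_⊆_)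
open import Data.List.Relation.Binary.Subset.Propositional.Properties
  as Subset using (filter-⊆)
open import Data.List.Relation.Binary.Permutation.Propositional
  using (_↭_; ↭-refl; ↭-prep; ↭-swap; ↭-trans; ↭-sym; ↭⇒↭ₛ)
open import Data.List.Relation.Binary.Permutation.Propositional.Properties
  using (∈-resp-↭; map⁺)
import Data.List.Relation.Binary.Permutation.Setoid.Properties as SetoidPerm
open import Data.List.Relation.Binary.Pointwise using (Pointwise; []; _∷_)
open import Data.Empty using (⊥; ⊥-elim)
open import Data.Unit using (⊤; tt)
open import Relation.Nullary using (¬_; yes; no)
open import Relation.Nullary.Decidable using (¬?)
open import Relation.Binary.PropositionalEquality
  using (_≡_; _≢_; refl; sym; trans; cong; subst; setoid)

mutual
  ≈ₛ-refl : ∀ σ → σ ≈ₛ σ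
  ≈ₛ-refl (atom p) = ≈-atom
  ≈ₛ-refl (α ⇒ σ) = ≈-⇒ (≈ᵢ-refl α) (≈ₛ-refl σ)

  ≈ᵢ-refl : ∀ α → α ≈ᵢ α
  ≈ᵢ-refl α = ≈-perm ↭-refl (≈ₛ-pointwise-refl α)

  ≈ₛ-pointwise-refl : ∀ α → Pointwise _≈ₛ_ α α
  ≈ₛ-pointwise-refl [] = []
  ≈ₛ-pointwise-refl (σ ∷ α) = ≈ₛ-refl σ ∷ ≈ₛ-pointwise-refl α

-- A permutation of a basis is an equal basis; this lets (conv) reorder
-- the entries of a basis before (→I) or (Cont) consumes the first ones.
↭⇒≋ : ∀ {Γ Γ' : Basis} → Γ ↭ Γ' → Γ ≋ Γ'
↭⇒≋ {Γ' = Γ'} p = Γ' , p , reflexive Γ'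
  where
  reflexive : ∀ Δ → Pointwise (λ p q → (proj₁ p ≡ proj₁ q) × (proj₂ p ≈ᵢ proj₂ q)) Δ Δ
  reflexive [] = []
  reflexive ((x , α) ∷ Δ) = (refl , ≈ᵢ-refl α) ∷ reflexive Δ

dom-++-top : ∀ (Γ Δ : Basis) → dom (Γ ++ top Δ) ≡ dom Γ ++ dom Δ
dom-++-top Γ Δ = trans (map-++ proj₁ Γ (top Δ)) (cong (dom Γ ++_) (sym (map-∘ Δ)))

∈-∖⁺ : ∀ {z x} {xs : List Var} → z ∈ xs → z ≢ x → z ∈ xs ∖ x
∈-∖⁺ {x = x} = ∈-filter⁺ (λ v → ¬? (v ≟ x))

∈-∖⁻ : ∀ {z x} (xs : List Var) → z ∈ xs ∖ x → z ∈ xs × z ≢ x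
∈-∖⁻ {x = x} xs = ∈-filter⁻ (λ v → ¬? (v ≟ x)) {xs = xs}

∉-∖ : ∀ {x} (xs : List Var) → x ∉ xs ∖ x
∉-∖ xs x∈ = proj₂ (∈-∖⁻ xs x∈) refl

record Scope (Γ : Basis) (xs : List Var) : Set where
  field
    unique   : Unique (dom Γ)
    sound    : dom Γ ⊆ xs
    complete : xs ⊆ dom Γ
open Scope

scope-∷ : ∀ {Γ xs x α} → x ∉ xs → Scope Γ xs → Scope ((x , α) ∷ Γ) (x ∷ xs)
scope-∷ x∉ S = record
  { unique   = All.tabulate (λ q x≡ → x∉ (sound S (subst (_∈ _) (sym x≡) q))) ∷ unique S
  ; sound    = λ { (here eq) → here eq ; (there q) → there (sound S q) }
  ; complete = λ { (here eq) → here eq ; (there q) → there (complete S q) }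
  }

scope-app : ∀ {Γ Δ xs ys} → Scope Γ xs → Scope Δ ys → Disjoint xs ys →
            Scope (Γ ++ top Δ) (xs ++ ys)
scope-app {Γ} {Δ} SΓ SΔ disj = record
  { unique   = subst Unique (sym dom≡)
                 (++⁺ (unique SΓ) (unique SΔ)
                      (λ (p , q) → disj (sound SΓ p) (sound SΔ q)))
  ; sound    = λ q → Subset.++⁺ (sound SΓ) (sound SΔ) (subst (_ ∈_) dom≡ q)
  ; complete = λ q → subst (_ ∈_) (sym dom≡) (Subset.++⁺ (complete SΓ) (complete SΔ) q)
  }
  where
  dom≡ : dom (Γ ++ top Δ) ≡ dom Γ ++ dom Δ
  dom≡ = dom-++-top Γ Δ

select : ∀ {x} (Γ : Basis) → x ∈ dom Γ → Σ Inter λ α → Σ Basis λ Γ' → Γ ↭ ((x , α) ∷ Γ')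
select ((y , β) ∷ Γ) (here refl) = β , Γ , ↭-refl
select ((y , β) ∷ Γ) (there x∈) with select Γ x∈
... | α , Γ' , p = α , (y , β) ∷ Γ' , ↭-trans (↭-prep _ p) (↭-swap _ _ ↭-refl)

unique-head : ∀ {x} {xs : List Var} → Unique (x ∷ xs) → x ∉ xs
unique-head (x≢ ∷ _) x∈ = All.lookup x≢ x∈ refl

unique-tail : ∀ {x} {xs : List Var} → Unique (x ∷ xs) → Unique xs
unique-tail (_ ∷ u) = u

record Removal (x : Var) (Γ : Basis) (xs : List Var) : Set where
  field
    entry : Inter
    rest  : Basis
    perm  : Γ ↭ ((x , entry) ∷ rest)
    fresh : x ∉ dom rest
    scope : Scope rest (xs ∖ x)

remove : ∀ {Γ xs x} → Scope Γ xs → x ∈ xs → Removal x Γ xs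
remove {Γ} {xs} {x} S x∈ with select Γ (complete S x∈)
... | α , Γ' , p = record
  { entry = α ; rest = Γ' ; perm = p
  ; fresh = unique-head uniqueFront
  ; scope = record
    { unique   = unique-tail uniqueFront
    ; sound    = λ q → ∈-∖⁺ (sound S (∈-resp-↭ (↭-sym domPerm) (there q)))
                            (λ z≡x → unique-head uniqueFront (subst (_∈ _) z≡x q))
    ; complete = complete'
    }
  }
  where
  domPerm : dom Γ ↭ x ∷ dom Γ'
  domPerm = map⁺ proj₁ p

  uniqueFront : Unique (x ∷ dom Γ')
  uniqueFront = SetoidPerm.Unique-resp-↭ (setoid Var) (↭⇒↭ₛ domPerm) (unique S)

  complete' : xs ∖ x ⊆ dom Γ'
  complete' q with ∈-∖⁻ xs q
  ... | z∈ , z≢x with ∈-resp-↭ domPerm (complete S z∈)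
  ...   | here eq = ⊥-elim (z≢x eq)
  ...   | there r = r

⊑-resp-≡s : ∀ {N M N'} → N ⊑ M → N ≡s N' → Σ Term λ M' → (M ≡s M') × (N' ⊑ M')
⊑-resp-≡s ⊑-refl e = _ , e , ⊑-refl
⊑-resp-≡s (⊑-lam s) e with ⊑-resp-≡s s e
... | M' , e' , s' = _ , ≡-lam e' , ⊑-lam s'
⊑-resp-≡s (⊑-appˡ s) e with ⊑-resp-≡s s e
... | M' , e' , s' = _ , ≡-app e' ≡-refl , ⊑-appˡ s'
⊑-resp-≡s (⊑-appʳ s) e with ⊑-resp-≡s s e
... | M' , e' , s' = _ , ≡-app ≡-refl e' , ⊑-appʳ s'
⊑-resp-≡s (⊑-ers s) e with ⊑-resp-≡s s e
... | M' , e' , s' = _ , ≡-ers e' , ⊑-ers s'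
⊑-resp-≡s (⊑-dup s) e with ⊑-resp-≡s s e
... | M' , e' , s' = _ , ≡-dup e' , ⊑-dup s'

⊑-trans : ∀ {K N M} → K ⊑ N → N ⊑ M → K ⊑ M
⊑-trans s ⊑-refl = s
⊑-trans s (⊑-lam t) = ⊑-lam (⊑-trans s t)
⊑-trans s (⊑-appˡ t) = ⊑-appˡ (⊑-trans s t)
⊑-trans s (⊑-appʳ t) = ⊑-appʳ (⊑-trans s t)
⊑-trans s (⊑-ers t) = ⊑-ers (⊑-trans s t)
⊑-trans s (⊑-dup t) = ⊑-dup (⊑-trans s t)

normal-⊑ : ∀ {N M} → NormalForm M → N ⊑ M → NormalForm N
normal-⊑ nf s N' e K k with ⊑-resp-≡s s e
... | M' , e' , s' = nf M' e' K (⊑-trans k s')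

normal-≡s-¬redex : ∀ {M M'} → NormalForm M → M ≡s M' → ¬ Redex M'
normal-≡s-¬redex nf e = nf _ e _ ⊑-refl

-- Neutral terms: neither abstractions nor erasures.  These are the
-- terms that can be typed with any strict type.
Neutral : Term → Set
Neutral (lam _ _) = ⊥
Neutral (ers _ _) = ⊥
Neutral _         = ⊤

normal-app-head : ∀ M {N} → NormalForm (app M N) → Neutral M
normal-app-head (var _)     nf = tt
normal-app-head (lam _ _)   nf = normal-≡s-¬redex nf ≡-refl r-β
normal-app-head (app _ _)   nf = tt
normal-app-head (ers _ _)   nf = normal-≡s-¬redex nf ≡-refl r-ω-appˡ
normal-app-head (dup _ _ _ _) nf = tt

-- The body of a duplication in normal form is neutral (otherwise it is a
-- γ-redex, or a γω-redex possibly after swapping the two copies).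
normal-dup-body : ∀ M {z x y} → NormalForm (dup z x y M) → Neutral M
normal-dup-body (var _)       nf = tt
normal-dup-body (lam _ _)     nf = normal-≡s-¬redex nf ≡-refl r-γ-lam
normal-dup-body (app _ _)     nf = tt
normal-dup-body (dup _ _ _ _) nf = tt
normal-dup-body (ers w _) {x = x} {y} nf with w ≟ x | w ≟ y
... | yes refl | _        = normal-≡s-¬redex nf ≡-refl r-γω-same
... | no _     | yes refl = normal-≡s-¬redex nf ax-dup-comm r-γω-same
... | no w≢x   | no w≢y   = normal-≡s-¬redex nf ≡-refl (r-γω w≢x w≢y)

record Typing (M : Term) (σ : Strict) : Set where
  constructor typing
  field
    basis   : Basis
    scoped  : Scope basis (fv M)
    derives : basis ⊢ M ∶ σ

mutual
  typeNeutral : ∀ M → WF M → NormalForm M → Neutral M → ∀ σ → Typing M σ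
  typeNeutral (var x) _ _ _ σ =
    typing _ (scope-∷ (λ ()) (record { unique = [] ; sound = λ () ; complete = λ () })) Ax
  typeNeutral (app M N) (wf-app wM wN disj) nf _ σ
    with typeNeutral M wM (normal-⊑ nf (⊑-appˡ ⊑-refl)) (normal-app-head M nf) ([] ⇒ σ)
       | typeNormal N wN (normal-⊑ nf (⊑-appʳ ⊑-refl))
  ... | typing Γ SΓ dM | τ , typing Δ SΔ dN =
    typing _ (scope-app SΓ SΔ disj)
      (→E {α = []} {Δs = []} dM dN [] [] (λ p q → disj (sound SΓ p) (sound SΔ q)))
  typeNeutral (dup z x y M) (wf-dup wM x∈ y∈ x≢y z∉) nf _ σ
    with typeNeutral M wM (normal-⊑ nf (⊑-dup ⊑-refl)) (normal-dup-body M nf) σ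
  ... | typing Γ SΓ dM with remove SΓ x∈
  ... | record { entry = α ; rest = Γ₁ ; perm = p₁ ; scope = S₁ }
    with remove S₁ (∈-∖⁺ y∈ (λ y≡x → x≢y (sym y≡x)))
  ... | record { entry = β ; rest = Γ₂ ; perm = p₂ ; fresh = y∉ ; scope = S₂ } =
    typing _ (scope-∷ z∉ S₂)
      (Cont x∉ y∉ x≢y (λ q → z∉ (sound S₂ q))
        (conv dM (↭⇒≋ (↭-trans p₁ (↭-prep _ p₂))) (≈ₛ-refl σ)))
    where
    x∉ : x ∉ dom Γ₂
    x∉ q = ∉-∖ (fv M) (filter-⊆ _ (fv M ∖ x) (sound S₂ q))

  typeNormal : ∀ M → WF M → NormalForm M → Σ Strict (Typing M)
  typeNormal (lam x M) (wf-lam wM x∈) nf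
    with typeNormal M wM (normal-⊑ nf (⊑-lam ⊑-refl))
  ... | σ , typing Γ SΓ dM with remove SΓ x∈
  ... | record { entry = α ; perm = p ; fresh = x∉ ; scope = S } =
    α ⇒ σ , typing _ S (→I x∉ (conv dM (↭⇒≋ p) (≈ₛ-refl σ)))
  typeNormal (ers x M) (wf-ers wM x∉) nf
    with typeNormal M wM (normal-⊑ nf (⊑-ers ⊑-refl))
  ... | σ , typing Γ SΓ dM =
    σ , typing _ (scope-∷ x∉ SΓ) (Thin (λ q → x∉ (sound SΓ q)) dM)
  typeNormal M@(var _)       wM nf = atom 0 , typeNeutral M wM nf tt (atom 0)
  typeNormal M@(app _ _)     wM nf = atom 0 , typeNeutral M wM nf tt (atom 0)
  typeNormal M@(dup _ _ _ _) wM nf = atom 0 , typeNeutral M wM nf tt (atom 0)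

mainTheorem12 : (M : Term) → WF M → NormalForm M →
    Σ Basis (λ Γ → Σ Strict (λ σ → Γ ⊢ M ∶ σ))
mainTheorem12 M wM nf with typeNormal M wM nf
... | σ , typing Γ _ d = Γ , σ , d
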